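{- Let $J$ be a g-cover of a cubic algebra $\mathcal L$ and let $x\in\mathcal L$. Then there exists a unique pair $\alpha,\beta\in J$ with $\alpha\ge\beta$ and $\Delta(\alpha,\beta)=x$.
   Context: A cubic algebra is a join-semilattice $\mathcal L$ with top $\mathbf 1$ and a binary operation $\Delta$ such that: if $x\le y$ then $\Delta(y,x)\vee x=y$; if $x\le y\le z$ then $\Delta(z,\Delta(y,x))=\Delta(\Delta(z,y),\Delta(z,x))$; if $x\le y$ then $\Delta(y,\Delta(y,x))=x$; if $x\le y\le z$ then $\Delta(z,x)\le\Delta(z,y)$; and with $xy:=\Delta(\mathbf 1,\Delta(x\vee y,y))\vee y$ one has $(xy)y=x\vee y$ and $x(yz)=y(xz)$. With $xy$, $\mathcal L$ is an implication algebra; an implication subalgebra is a subset closed under it. $a\sim b$ iff $\Delta(a\vee b,a)=b$; $\mathcal L/\!\sim$ is an implication algebra with $[a]\le[b]$ iff $\Delta(a\vee b,a)\le b$, $[a]\vee[b]=[a\vee\Delta(a\vee b,b)]$, $[a]\to[b]=[\Delta(a\vee b,a)\,b]$. With $\eta$ the quotient map, a g-cover is an upwards-closed implication subalgebra $J\subseteq\mathcal L$ such that $\eta|_J\colon J\to\mathcal L/\!\sim$ is an isomorphism. -}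

module Defs where

open import Level using (Level; suc; _⊔_)
open import Data.Product using (Σ; _×_; _,_; ∃)
open import Relation.Binary.PropositionalEquality using (_≡_)
open import Relation.Binary.Lattice using (IsJoinSemilattice)
open import Relation.Binary.Definitions using (Maximum)

record CubicAlgebra (c ℓ : Level) : Set (suc (c ⊔ ℓ)) where
  infix  4 _≤_
  infixr 6 _∨_
  field
    Carrier : Set c
    _≤_     : Carrier → Carrier → Set ℓ
    _∨_     : Carrier → Carrier → Carrier
    𝟏       : Carrier
    Δ       : Carrier → Carrier → Carrier
    isJoinSemilattice : IsJoinSemilattice _≡_ _≤_ _∨_
    top     : Maximum _≤_ 𝟏

  _⇒_ : Carrier → Carrier → Carrier
  x ⇒ y = Δ 𝟏 (Δ (x ∨ y) y) ∨ y

  field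
    ax1 : ∀ {x y} → x ≤ y → Δ y x ∨ x ≡ y
    ax2 : ∀ {x y z} → x ≤ y → y ≤ z → Δ z (Δ y x) ≡ Δ (Δ z y) (Δ z x)
    ax3 : ∀ {x y} → x ≤ y → Δ y (Δ y x) ≡ x
    ax4 : ∀ {x y z} → x ≤ y → y ≤ z → Δ z x ≤ Δ z y
    ax5 : ∀ x y → (x ⇒ y) ⇒ y ≡ x ∨ y
    ax6 : ∀ x y z → x ⇒ (y ⇒ z) ≡ y ⇒ (x ⇒ z)

  -- a ~ b  iff  Δ(a ∨ b, a) = b ; equality in L/~ of classes [a],[b]
  _∼_ : Carrier → Carrier → Set c
  a ∼ b = Δ (a ∨ b) a ≡ b

  -- implication in the quotient on representatives: [a] → [b] = [Δ(a∨b,a) b]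
  _⇒∼_ : Carrier → Carrier → Carrier
  a ⇒∼ b = Δ (a ∨ b) a ⇒ b

  UpClosed : (Carrier → Set ℓ) → Set (c ⊔ ℓ)
  UpClosed J = ∀ {a b} → J a → a ≤ b → J b

  ImplicationSubalgebra : (Carrier → Set ℓ) → Set (c ⊔ ℓ)
  ImplicationSubalgebra J = ∀ {a b} → J a → J b → J (a ⇒ b)

  -- η restricted to J is an isomorphism of implication algebras J → L/~ :
  -- a homomorphism which is bijective (equality in L/~ being ∼).
  EtaIso : (Carrier → Set ℓ) → Set (c ⊔ ℓ)
  EtaIso J =
      (∀ {a b} → J a → J b → (a ⇒ b) ∼ (a ⇒∼ b))
    × (∀ {a b} → J a → J b → a ∼ b → a ≡ b)
    × (∀ x → Σ Carrier λ a → J a × (a ∼ x))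

  record IsGCover (J : Carrier → Set ℓ) : Set (c ⊔ ℓ) where
    field
      upClosed   : UpClosed J
      subalgebra : ImplicationSubalgebra J
      etaIso     : EtaIso J

module Submission where

-- Call A a J-frame of x if A ∈ J, x ≤ A and Δ(A, x) ∈ J.
-- Because Δ(A, -) is an involution on the interval below A (axioms 1, 3),
-- pairs (α, β) as in the lemma are exactly the pairs (A, Δ(A, x)) with A
-- a J-frame of x.  So the lemma says: x has exactly one J-frame.
--   * Existence: surjectivity of η|J gives a ∈ J with a ∼ x; then a ∨ x
--     is a frame, since J is upwards closed and Δ(a ∨ x, x) = a.
--   * Uniqueness: a frame A lies below every B ∈ J above x.  Indeed with
--     a = Δ(A, x) and E = A ⇒ B ∈ J one gets a ∨ E = 𝟏 and Δ(𝟏, a) ≤ E,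
--     so [a] → [E] is the top class; since η|J is a homomorphism this
--     forces a ⇒ E = 𝟏, hence A = a ∨ x ≤ E, hence A ⇒ B = 𝟏 and A ≤ B.

open import Defs
open import Level using (Level)
open import Data.Product using (Σ; _×_; _,_; proj₁; proj₂)
open import Relation.Binary.PropositionalEquality
  using (_≡_; refl; sym; trans; cong; subst; module ≡-Reasoning)
open import Relation.Binary.Lattice using (IsJoinSemilattice; JoinSemilattice)
import Relation.Binary.Lattice.Properties.JoinSemilattice as JoinSemilatticeProperties

module CubicAlgebraProperties {c ℓ : Level} (L : CubicAlgebra c ℓ) where
  open CubicAlgebra L
  open IsJoinSemilattice isJoinSemilattice
    using (x≤x∨y; y≤x∨y; ∨-least; antisym)
    renaming (refl to ≤-refl; trans to ≤-trans)

  joinSemilattice : JoinSemilattice c c ℓ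
  joinSemilattice = record { isJoinSemilattice = isJoinSemilattice }

  open JoinSemilatticeProperties joinSemilattice
    using (∨-comm; x≤y⇒x∨y≈y; ∨-monotonic)

  top-unique : ∀ {x} → 𝟏 ≤ x → x ≡ 𝟏
  top-unique 𝟏≤x = antisym (top _) 𝟏≤x

  Δ-≤ : ∀ {x y} → x ≤ y → Δ y x ≤ y
  Δ-≤ {x} {y} x≤y = subst (Δ y x ≤_) (ax1 x≤y) (x≤x∨y (Δ y x) x)

  Δ-self : ∀ y → Δ y y ≡ y
  Δ-self y = antisym (Δ-≤ ≤-refl)
    (subst (_≤ Δ y y) (ax3 ≤-refl) (ax4 (Δ-≤ ≤-refl) ≤-refl))

  ∼𝟏⇒≡𝟏 : ∀ {y} → y ∼ 𝟏 → y ≡ 𝟏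
  ∼𝟏⇒≡𝟏 {y} y∼𝟏 = begin
      y                 ≡⟨ sym (ax3 (top y)) ⟩
      Δ 𝟏 (Δ 𝟏 y)       ≡⟨ cong (λ t → Δ 𝟏 (Δ t y)) (sym (x≤y⇒x∨y≈y (top y))) ⟩
      Δ 𝟏 (Δ (y ∨ 𝟏) y) ≡⟨ cong (Δ 𝟏) y∼𝟏 ⟩
      Δ 𝟏 𝟏             ≡⟨ Δ-self 𝟏 ⟩
      𝟏                 ∎
    where open ≡-Reasoning

  ∼-reflect : ∀ {a x} → a ∼ x → Δ (a ∨ x) x ≡ a
  ∼-reflect {a} {x} a∼x = subst (λ t → Δ (a ∨ x) t ≡ a) a∼x (ax3 (x≤x∨y a x))

  ≤⇒⇒≡𝟏 : ∀ {u v} → u ≤ v → u ⇒ v ≡ 𝟏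
  ≤⇒⇒≡𝟏 {u} {v} u≤v
    rewrite x≤y⇒x∨y≈y u≤v | Δ-self v = ax1 (top v)

  𝟏⇒-identity : ∀ v → 𝟏 ⇒ v ≡ v
  𝟏⇒-identity v
    rewrite ∨-comm 𝟏 v | x≤y⇒x∨y≈y (top v) | ax3 (top v) = x≤y⇒x∨y≈y ≤-refl

  -- u ⇒ v = 𝟏 forces u ≤ v, since (u ⇒ v) ⇒ v = u ∨ v.
  ⇒≡𝟏⇒≤ : ∀ {u v} → u ⇒ v ≡ 𝟏 → u ≤ v
  ⇒≡𝟏⇒≤ {u} {v} u⇒v≡𝟏 = subst (u ≤_) v≡u∨v (x≤x∨y u v)
    where
      v≡u∨v : u ∨ v ≡ v
      v≡u∨v = trans (sym (ax5 u v))
                (trans (cong (_⇒ v) u⇒v≡𝟏) (𝟏⇒-identity v))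

  consequent-≤ : ∀ u v → v ≤ u ⇒ v
  consequent-≤ u v = y≤x∨y _ v

  -- For x ≤ A, the reflection Δ(𝟏, Δ(A, x)) is the first joinand of A ⇒ x.
  Δ𝟏Δ-≤-⇒ : ∀ {A x} → x ≤ A → Δ 𝟏 (Δ A x) ≤ A ⇒ x
  Δ𝟏Δ-≤-⇒ {A} {x} x≤A =
    subst (λ t → Δ 𝟏 (Δ t x) ≤ A ⇒ x)
      (trans (∨-comm A x) (x≤y⇒x∨y≈y x≤A)) (x≤x∨y _ x)

  ⇒-monoʳ : ∀ {A x B} → x ≤ B → A ⇒ x ≤ A ⇒ B
  ⇒-monoʳ {A} {x} {B} x≤B = subst (A ⇒ x ≤_) exchange (consequent-≤ (B ⇒ x) (A ⇒ x))
    where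
      exchange : (B ⇒ x) ⇒ (A ⇒ x) ≡ A ⇒ B
      exchange = trans (sym (ax6 A (B ⇒ x) x))
        (cong (A ⇒_) (trans (ax5 B x) (trans (∨-comm B x) (x≤y⇒x∨y≈y x≤B))))

  𝟏-split : ∀ A B → Δ 𝟏 (Δ (A ∨ B) B) ∨ (A ∨ B) ≡ 𝟏
  𝟏-split A B = top-unique
    (subst (_≤ Δ 𝟏 (Δ (A ∨ B) B) ∨ (A ∨ B)) (ax1 (top _))
      (∨-monotonic ≤-refl (Δ-≤ (y≤x∨y A B))))

  -- The analogue of  A ∨ ¬A = 𝟏  for implication algebras.
  ∨-⇒-≡𝟏 : ∀ A B → A ∨ (A ⇒ B) ≡ 𝟏
  ∨-⇒-≡𝟏 A B = top-unique (subst (_≤ A ∨ (A ⇒ B)) (𝟏-split A B)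
    (∨-least (≤-trans (x≤x∨y _ B) (y≤x∨y A _))
             (∨-least (x≤x∨y A _) (≤-trans (consequent-≤ A B) (y≤x∨y A _)))))

  ≤⇒-absorb : ∀ {A B} → A ≤ A ⇒ B → A ⇒ B ≡ 𝟏
  ≤⇒-absorb {A} {B} A≤A⇒B = trans (sym (x≤y⇒x∨y≈y A≤A⇒B)) (∨-⇒-≡𝟏 A B)

  module GCoverFrames (J : Carrier → Set ℓ) (gc : IsGCover J) where
    open IsGCover gc

    record Frame (x A : Carrier) : Set ℓ where
      field
        inJ        : J A
        above      : x ≤ A
        reflection : J (Δ A x)

    frame-least : ∀ {x A B} → Frame x A → J B → x ≤ B → A ≤ B
    frame-least {x} {A} {B} record { inJ = JA ; above = x≤A ; reflection = Ja }
                JB x≤B = ⇒≡𝟏⇒≤ (≤⇒-absorb A≤E)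
      where
        a = Δ A x
        E = A ⇒ B
        JE : J E
        JE = subalgebra JA JB
        x≤E : x ≤ E
        x≤E = ≤-trans x≤B (consequent-≤ A B)
        a∨E≡𝟏 : a ∨ E ≡ 𝟏
        a∨E≡𝟏 = top-unique (subst (_≤ a ∨ E) (∨-⇒-≡𝟏 A B)
          (∨-least (subst (_≤ a ∨ E) (ax1 x≤A) (∨-monotonic ≤-refl x≤E))
                   (y≤x∨y a E)))
        [a]⇒[E]≡𝟏 : a ⇒∼ E ≡ 𝟏
        [a]⇒[E]≡𝟏 = trans (cong (λ t → Δ t a ⇒ E) a∨E≡𝟏)
                          (≤⇒⇒≡𝟏 (≤-trans (Δ𝟏Δ-≤-⇒ x≤A) (⇒-monoʳ x≤B)))
        a⇒E≡𝟏 : a ⇒ E ≡ 𝟏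
        a⇒E≡𝟏 = ∼𝟏⇒≡𝟏 (subst ((a ⇒ E) ∼_) [a]⇒[E]≡𝟏 (proj₁ etaIso Ja JE))
        A≤E : A ≤ E
        A≤E = subst (_≤ E) (ax1 x≤A) (∨-least (⇒≡𝟏⇒≤ a⇒E≡𝟏) x≤E)

    frame-unique : ∀ {x A A′} → Frame x A → Frame x A′ → A ≡ A′
    frame-unique fr fr′ =
      antisym (frame-least fr (Frame.inJ fr′) (Frame.above fr′))
              (frame-least fr′ (Frame.inJ fr) (Frame.above fr))

    frame-exists : ∀ x → Σ Carrier (Frame x)
    frame-exists x with proj₂ (proj₂ etaIso) x
    ... | a , Ja , a∼x = a ∨ x , record
      { inJ        = upClosed Ja (x≤x∨y a x)
      ; above      = y≤x∨y a x
      ; reflection = subst J (sym (∼-reflect a∼x)) Ja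
      }

    pair⇒frame : ∀ {x α β} → J α → J β → β ≤ α → Δ α β ≡ x →
                 Frame x α × Δ α x ≡ β
    pair⇒frame {x} {α} {β} Jα Jβ β≤α Δαβ≡x =
      record { inJ = Jα ; above = x≤α ; reflection = subst J (sym Δαx≡β) Jβ }
      , Δαx≡β
      where
        x≤α : x ≤ α
        x≤α = subst (_≤ α) Δαβ≡x (Δ-≤ β≤α)
        Δαx≡β : Δ α x ≡ β
        Δαx≡β = subst (λ t → Δ α t ≡ β) Δαβ≡x (ax3 β≤α)

lemma5p3 : ∀ {c ℓ : Level} (L : CubicAlgebra c ℓ) → let open CubicAlgebra L in
    (J : Carrier → Set ℓ) → IsGCover J → (x : Carrier) →
    Σ Carrier λ α → Σ Carrier λ β →
    (J α × J β × β ≤ α × Δ α β ≡ x)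
    × (∀ α′ β′ → J α′ → J β′ → β′ ≤ α′ → Δ α′ β′ ≡ x → (α′ ≡ α × β′ ≡ β))
lemma5p3 L J gc x = α , Δ α x , (inJ , reflection , Δ-≤ above , ax3 above) , unique
  where
    open CubicAlgebra L
    open CubicAlgebraProperties L
    open GCoverFrames J gc
    α = proj₁ (frame-exists x)
    open Frame (proj₂ (frame-exists x))

    unique : ∀ α′ β′ → J α′ → J β′ → β′ ≤ α′ → Δ α′ β′ ≡ x → α′ ≡ α × β′ ≡ Δ α x
    unique α′ β′ Jα′ Jβ′ β′≤α′ Δα′β′≡x with pair⇒frame Jα′ Jβ′ β′≤α′ Δα′β′≡x
    ... | frame′ , Δα′x≡β′ with frame-unique frame′ (proj₂ (frame-exists x))
    ... | refl = refl , sym Δα′x≡β′
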